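{- Let $G$ be a plane graph with $n$ vertices, let $\alpha$ be a proper $5$-coloring of $G$ and let $\beta$ be a proper $4$-coloring of $G$. Then there exists an independent set $I$ of $G$ such that: all vertices of $I$ have degree at most $6$ in $G$; $I$ is contained in a single color class of $\alpha$ and in a single color class of $\beta$; and $|I|\ge n/140$.
   Context: A proper $k$-coloring of $G$ is a map $V(G)\to\{1,\dots,k\}$ giving adjacent vertices distinct colors; a color class is the set of vertices receiving a given color. -}

module Defs where

open import Data.Nat using (ℕ; zero; suc; _+_; _*_; _≤_; _≤ᵇ_)
open import Data.Fin using (Fin; toℕ; _≟_)
open import Data.Bool using (Bool; true; false; _∧_; _∨_; not; if_then_else_)
open import Data.Product using (_×_; _,_; Σ; ∃; ∃-syntax)
open import Relation.Nullary.Decidable using (⌊_⌋)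
open import Relation.Binary.PropositionalEquality using (_≡_; _≢_)

record Graph (n : ℕ) : Set where
  field
    adj   : Fin n → Fin n → Bool
    sym   : ∀ u v → adj u v ≡ adj v u
    irref : ∀ v → adj v v ≡ false
open Graph public

sumF : ∀ {n} → (Fin n → ℕ) → ℕ
sumF {zero}  f = 0
sumF {suc n} f = f Fin.zero + sumF {n} (λ i → f (Fin.suc i))

count : ∀ {n} → (Fin n → Bool) → ℕ
count p = sumF (λ i → if p i then 1 else 0)

anyF : ∀ {n} → (Fin n → Bool) → Bool
anyF {zero}  p = false
anyF {suc n} p = p Fin.zero ∨ anyF {n} (λ i → p (Fin.suc i))

allF : ∀ {n} → (Fin n → Bool) → Bool
allF {zero}  p = true
allF {suc n} p = p Fin.zero ∧ allF {n} (λ i → p (Fin.suc i))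

allBelow : ℕ → (ℕ → Bool) → Bool
allBelow zero    p = true
allBelow (suc N) p = allBelow N p ∧ p N

iter : ∀ {A : Set} → ℕ → (A → A) → A → A
iter zero    f a = a
iter (suc k) f a = f (iter k f a)

module _ {n : ℕ} (G : Graph n) where

  degree : Fin n → ℕ
  degree v = count (adj G v)

  -- number of darts (ordered adjacent pairs) = 2 |E(G)|
  dartCount : ℕ
  dartCount = sumF degree

  isolatedCount : ℕ
  isolatedCount = count (λ v → not (anyF (adj G v)))

  reach : ℕ → Fin n → Fin n → Bool
  reach zero    v w = ⌊ v ≟ w ⌋
  reach (suc k) v w = reach k v w ∨ anyF (λ u → reach k v u ∧ adj G u w)

  -- number of connected components: count the vertices that are the
  -- least (in the order of Fin n) vertex of their component
  componentCount : ℕ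
  componentCount =
    count (λ v → allF (λ w → not (reach n v w) ∨ (toℕ v ≤ᵇ toℕ w)))

  -- Combinatorial embeddings (rotation systems).
  -- ρ v u is the neighbour of v following u in the clockwise cyclic
  -- order of the neighbours of v (only meaningful when u ~ v).

  IsRotation : (Fin n → Fin n → Fin n) → Set
  IsRotation ρ =
      (∀ v u → adj G v u ≡ true → adj G v (ρ v u) ≡ true)
    × (∀ v u w → adj G v u ≡ true → adj G v w ≡ true →
         ∃[ k ] iter k (ρ v) u ≡ w)

  -- face-tracing permutation on darts (v , u) ↦ (u , ρ u v)
  faceStep : (Fin n → Fin n → Fin n) → Fin n × Fin n → Fin n × Fin n
  faceStep ρ (v , u) = (u , ρ u v)

  dartCode : Fin n × Fin n → ℕ
  dartCode (v , u) = toℕ v * n + toℕ u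

  -- number of faces of the embedding given by ρ = number of orbits of
  -- faceStep ρ on darts (each orbit counted at its least dart; orbits
  -- have length ≤ n * n)
  faceCount : (Fin n → Fin n → Fin n) → ℕ
  faceCount ρ = sumF (λ v → count (λ u →
      adj G v u ∧
      allBelow (n * n) (λ k →
        dartCode (v , u) ≤ᵇ dartCode (iter k (faceStep ρ) (v , u)))))

  -- Planar (genus 0) rotation system: Euler's formula
  --   V - E + F = 1 + C   (F counting the outer face once),
  -- computed per component as  V - E + F' + I = 2C, where F' counts
  -- dart-orbit faces and each isolated vertex contributes its own face;
  -- multiplied by 2 to use darts (D = 2E).
  IsPlaneEmbedding : (Fin n → Fin n → Fin n) → Set
  IsPlaneEmbedding ρ =
    IsRotation ρ ×
    (2 * n + 2 * faceCount ρ + 2 * isolatedCount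
       ≡ dartCount + 4 * componentCount)

  Planar : Set
  Planar = ∃[ ρ ] IsPlaneEmbedding ρ

  ProperColoring : (k : ℕ) → (Fin n → Fin k) → Set
  ProperColoring k c = ∀ u v → adj G u v ≡ true → c u ≢ c v

  Independent : (Fin n → Bool) → Set
  Independent I = ∀ u v → I u ≡ true → I v ≡ true → adj G u v ≡ false

{-# OPTIONS --safe #-}

-- Faces of the plane embedding ρ are the orbits of the face-tracing permutation on the D darts.
-- No orbit has length one (that would be a loop) and an orbit of length two is an isolated edge,
-- so if K faces are of that kind, 3F ≤ D + K. Isolated edges and the I isolated vertices are
-- distinct components, so K + I ≤ C. With the Euler relation 2n + 2F + 2I = D + 4C this gives
-- D ≤ 6n. By Markov's inequality at least n/7 vertices have degree at most 6, and one of the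
-- 5 · 4 classes of (α, β)-colours contains a twentieth of them.
module Submission where

open import Algebra.Properties.CommutativeSemigroup using (interchange)
open import Data.Bool using (Bool; true; false; _∧_; _∨_; not; if_then_else_; T)
open import Data.Bool.Properties using (∧-conicalˡ; ∧-conicalʳ; T-≡) renaming (_≟_ to _≟ᵇ_)
open import Data.Empty using (⊥-elim)
open import Data.Fin using (Fin; zero; suc; toℕ; fromℕ<; combine; _≟_)
open import Data.Fin.Properties
  using (pigeonhole; injective⇒≤; toℕ-fromℕ<; toℕ<n; toℕ-injective; suc-injective; 0≢1+n;
         toℕ-combine; combine-injective; combine-monoˡ-<)
open import Data.List
  using (List; []; _∷_; lookup; _++_; length; map; filter; tabulate; allFin; cartesianProduct)
open import Data.List.Properties using (length-++; length-map; filter-++; map-tabulate)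
open import Data.List.Membership.Propositional using (_∈_)
open import Data.List.Membership.Propositional.Properties
  using (∈-lookup; ∈-filter⁻; ∈-filter⁺; ∈-map⁻; ∈-++⁻; ∈-allFin; ∈-cartesianProduct⁺)
open import Data.List.Membership.Setoid.Properties using (index-injective)
open import Data.List.Relation.Binary.Disjoint.Propositional using (Disjoint)
open import Data.List.Relation.Binary.Subset.Propositional using (_⊆_)
open import Data.List.Relation.Unary.All using (All)
import Data.List.Relation.Unary.All as All
import Data.List.Relation.Unary.All.Properties as All
import Data.List.Relation.Unary.AllPairs as AllPairs
open import Data.List.Relation.Unary.Unique.Propositional using (Unique)
import Data.List.Relation.Unary.Unique.Propositional.Properties as Unique
open import Data.Nat using (ℕ; zero; suc; _+_; _*_; _≤_; _<_; _≤ᵇ_; _≤?_; z≤n; s≤s; s≤s⁻¹)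
open import Data.Nat.DivMod using (_%_; _/_; m≡m%n+[m/n]*n; m%n<n)
open import Data.Nat.Properties
  using (+-comm; +-assoc; +-suc; +-identityʳ; *-comm; *-assoc; *-suc; *-zeroʳ; *-identityʳ;
         *-distribˡ-+; +-commutativeSemigroup; ≤-refl; ≤-trans; ≤-reflexive; ≤-antisym; ≤-total;
         <-≤-trans; ≰⇒≥; ≰⇒>; ≮⇒≥; <⇒≱; n<1+n; m≤m+n; m≤n+m; m≤n⇒m<n∨m≡n; m≤n⇒∃[o]m+o≡n;
         +-mono-≤; +-monoˡ-≤; +-monoʳ-≤; *-monoˡ-≤; *-monoʳ-≤; +-cancelʳ-≤; ≤ᵇ⇒≤; ≤⇒≤ᵇ; module ≤-Reasoning)
  renaming (_≟_ to _≟ℕ_)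
open import Data.Nat.Tactic.RingSolver using (solve-∀; solve)
open import Data.Product using (_×_; _,_; proj₁; proj₂; ∃-syntax)
open import Data.Sum using (_⊎_; inj₁; inj₂)
open import Function.Base using (_∘_; case_of_)
open import Function.Bundles using (Equivalence)
open import Relation.Binary.Definitions using (DecidableEquality)
open import Relation.Binary.PropositionalEquality
  using (_≡_; _≢_; refl; sym; trans; cong; cong₂; subst; subst₂; setoid; module ≡-Reasoning)
open import Relation.Nullary using (yes; no)
open import Relation.Nullary.Decidable using (⌊_⌋; ⌊⌋-map′; map′; toWitness; toWitnessFalse)
open import Relation.Unary using (Decidable)

open import Defs renaming (sym to adj-sym)

private
  variable
    A : Set
    n k : ℕ

anyF-witness : (p : Fin n → Bool) → anyF p ≡ true → ∃[ i ] p i ≡ true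
anyF-witness {suc n} p e with p zero in p0
... | true  = zero , p0
... | false = let i , pi = anyF-witness (λ i → p (suc i)) e in suc i , pi

anyF-intro : (p : Fin n → Bool) (i : Fin n) → p i ≡ true → anyF p ≡ true
anyF-intro p zero    pi rewrite pi = refl
anyF-intro p (suc i) pi with p zero
... | true  = refl
... | false = anyF-intro (λ j → p (suc j)) i pi

allF-intro : (p : Fin n → Bool) → (∀ i → p i ≡ true) → allF p ≡ true
allF-intro {zero}  p h = refl
allF-intro {suc n} p h rewrite h zero = allF-intro (λ i → p (suc i)) (λ i → h (suc i))

allBelow-elim : ∀ N p {k} → allBelow N p ≡ true → k < N → p k ≡ true
allBelow-elim (suc N) p {k} _ k<N with allBelow N p in below | p N in top
... | true | true with m≤n⇒m<n∨m≡n (s≤s⁻¹ k<N)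
...   | inj₁ k<N′  = allBelow-elim N p below k<N′
...   | inj₂ refl  = top

iter-+ : ∀ m n (f : A → A) x → iter (m + n) f x ≡ iter m f (iter n f x)
iter-+ zero    n f x = refl
iter-+ (suc m) n f x = cong f (iter-+ m n f x)

iter-fixed : ∀ k (f : A → A) {x} → f x ≡ x → iter k f x ≡ x
iter-fixed zero    f fx = refl
iter-fixed (suc k) f fx = trans (cong f (iter-fixed k f fx)) fx

iter-periodic : ∀ p (f : A → A) {x} → iter p f x ≡ x → ∀ q → iter (q * p) f x ≡ x
iter-periodic p f per zero    = refl
iter-periodic p f per (suc q) =
  trans (iter-+ p (q * p) f _) (trans (cong (iter p f) (iter-periodic p f per q)) per)

module _ (g : A → A) {y : A} where

  returns-twice-≤ : ∀ {a b} → a ≤ b →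
                    iter (suc a) g y ≡ y → iter (suc b) g y ≡ y → iter a g y ≡ iter b g y
  returns-twice-≤ {a} a≤b ret-a ret-b with d , refl ← m≤n⇒∃[o]m+o≡n a≤b = sym (begin
    iter (a + d) g y          ≡⟨ iter-+ a d g y ⟩
    iter a g (iter d g y)     ≡⟨ cong (iter a g) d-period ⟩
    iter a g y                ∎)
    where
    open ≡-Reasoning
    d-period : iter d g y ≡ y
    d-period = begin
      iter d g y                      ≡⟨ cong (iter d g) ret-a ⟨
      iter d g (iter (suc a) g y)     ≡⟨ iter-+ d (suc a) g y ⟨
      iter (d + suc a) g y            ≡⟨ cong (λ m → iter m g y) (trans (+-suc d a) (cong suc (+-comm d a))) ⟩
      iter (suc (a + d)) g y          ≡⟨ ret-b ⟩
      y                               ∎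

  returns-twice : ∀ a b → iter (suc a) g y ≡ y → iter (suc b) g y ≡ y → iter a g y ≡ iter b g y
  returns-twice a b ret-a ret-b with ≤-total a b
  ... | inj₁ a≤b = returns-twice-≤ a≤b ret-a ret-b
  ... | inj₂ b≤a = sym (returns-twice-≤ b≤a ret-b ret-a)

single-orbit⇒injectiveOn : (g : A → A) (P : A → Set) →
  (∀ {x} → P x → P (g x)) → (∀ {x y} → P x → P y → ∃[ k ] iter k g x ≡ y) →
  ∀ {x x′} → P x → P x′ → g x ≡ g x′ → x ≡ x′
single-orbit⇒injectiveOn g P closed single {x} {x′} px px′ gx≡gx′
  with a , x-reached ← single (closed px) px | b , x′-reached ← single (closed px) px′ = begin
    x              ≡⟨ x-reached ⟨
    iter a g (g x) ≡⟨ returns-twice g a b (cong g x-reached) (trans (cong g x′-reached) (sym gx≡gx′)) ⟩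
    iter b g (g x) ≡⟨ x′-reached ⟩
    x′             ∎
  where open ≡-Reasoning

-- Finite sums and counting

sumF-cong : {f g : Fin n → ℕ} → (∀ i → f i ≡ g i) → sumF f ≡ sumF g
sumF-cong {zero}  h = refl
sumF-cong {suc n} h = cong₂ _+_ (h zero) (sumF-cong (λ i → h (suc i)))

sumF-mono : {f g : Fin n → ℕ} → (∀ i → f i ≤ g i) → sumF f ≤ sumF g
sumF-mono {zero}  h = z≤n
sumF-mono {suc n} h = +-mono-≤ (h zero) (sumF-mono (λ i → h (suc i)))

sumF-const : ∀ c → sumF {n} (λ _ → c) ≡ n * c
sumF-const {zero}  c = refl
sumF-const {suc n} c = cong (c +_) (sumF-const {n} c)

sumF-+ : (f g : Fin n → ℕ) → sumF (λ i → f i + g i) ≡ sumF f + sumF g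
sumF-+ {zero}  f g = refl
sumF-+ {suc n} f g = trans (cong (f zero + g zero +_) (sumF-+ (λ i → f (suc i)) (λ i → g (suc i))))
                           (interchange +-commutativeSemigroup (f zero) (g zero) _ _)

sumF-scale : ∀ c (f : Fin n → ℕ) → sumF (λ i → c * f i) ≡ c * sumF f
sumF-scale {zero}  c f = sym (*-zeroʳ c)
sumF-scale {suc n} c f = trans (cong (c * f zero +_) (sumF-scale c (λ i → f (suc i))))
                               (sym (*-distribˡ-+ c (f zero) _))

sumF-swap : (h : Fin n → Fin k → ℕ) → sumF (λ i → sumF (h i)) ≡ sumF (λ j → sumF (λ i → h i j))
sumF-swap {zero}  {k} h = sym (trans (sumF-const {k} 0) (*-zeroʳ k))
sumF-swap {suc n} {k} h = trans (cong (sumF (h zero) +_) (sumF-swap (λ i → h (suc i))))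
                                (sym (sumF-+ (h zero) _))

maximum-index : (f : Fin (suc n) → ℕ) → ∃[ i ] (∀ j → f j ≤ f i)
maximum-index {zero}  f = zero , λ { zero → ≤-refl }
maximum-index {suc n} f with maximum-index (λ i → f (suc i))
... | i , max with f zero ≤? f (suc i)
...   | yes f0≤ = suc i , λ { zero → f0≤ ; (suc j) → max j }
...   | no  f0≰ = zero  , λ { zero → ≤-refl ; (suc j) → ≤-trans (max j) (≰⇒≥ f0≰) }

sumF-≤-size*max : (f : Fin (suc n) → ℕ) → ∃[ i ] sumF f ≤ suc n * f i
sumF-≤-size*max {n} f = let i , max = maximum-index f in
  i , ≤-trans (sumF-mono max) (≤-reflexive (sumF-const {suc n} (f i)))

count-≡0 : (p : Fin n → Bool) → (∀ i → p i ≢ true) → count p ≡ 0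
count-≡0 {zero}  p none = refl
count-≡0 {suc n} p none with p zero in p0
... | true  = ⊥-elim (none zero p0)
... | false = count-≡0 (λ i → p (suc i)) (λ i → none (suc i))

count-≤1 : (p : Fin n → Bool) → (∀ i j → p i ≡ true → p j ≡ true → i ≡ j) → count p ≤ 1
count-≤1 {zero}  p unique = z≤n
count-≤1 {suc n} p unique with p zero in p0
... | true  = ≤-reflexive (cong suc (count-≡0 (λ i → p (suc i)) λ i pi → 0≢1+n (unique zero (suc i) p0 pi)))
... | false = count-≤1 (λ i → p (suc i)) (λ i j pi pj → suc-injective (unique (suc i) (suc j) pi pj))

count-≟ : (x : Fin k) → count (λ a → ⌊ x ≟ a ⌋) ≡ 1
count-≟ {suc k} zero    = cong suc (count-≡0 {k} (λ _ → false) (λ _ ()))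
count-≟ {suc k} (suc x) = trans (sumF-cong (λ i → cong (if_then 1 else 0) (⌊⌋-map′ _ _ (x ≟ i)))) (count-≟ x)

count-partition : (p : Fin n → Bool) (c : Fin n → Fin k) →
                  count p ≡ sumF (λ a → count (λ v → p v ∧ ⌊ c v ≟ a ⌋))
count-partition {k = k} p c = trans (sumF-cong split) (sumF-swap (λ v a → if p v ∧ ⌊ c v ≟ a ⌋ then 1 else 0))
  where
  split : ∀ v → (if p v then 1 else 0) ≡ count (λ a → p v ∧ ⌊ c v ≟ a ⌋)
  split v with p v
  ... | true  = sym (count-≟ (c v))
  ... | false = sym (count-≡0 {k} (λ _ → false) (λ _ ()))

count-pigeonhole : (p : Fin n → Bool) (c : Fin n → Fin (suc k)) →
                   ∃[ a ] count p ≤ suc k * count (λ v → p v ∧ ⌊ c v ≟ a ⌋)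
count-pigeonhole p c = let a , bound = sumF-≤-size*max (λ a → count (λ v → p v ∧ ⌊ c v ≟ a ⌋)) in
  a , ≤-trans (≤-reflexive (count-partition p c)) bound

many-small-terms : (f : Fin n → ℕ) (c : ℕ) → sumF f ≤ c * n → n ≤ suc c * count (λ v → f v ≤ᵇ c)
many-small-terms {n} f c total = +-cancelʳ-≤ (c * n) n (suc c * count small) (begin
  n + c * n                                                 ≡⟨ *-comm (suc c) n ⟩
  n * suc c                                                 ≡⟨ sumF-const {n} (suc c) ⟨
  sumF {n} (λ _ → suc c)                                    ≤⟨ sumF-mono large-or-small ⟩
  sumF (λ v → f v + suc c * indicator v)                    ≡⟨ sumF-+ f (λ v → suc c * indicator v) ⟩
  sumF f + sumF (λ v → suc c * indicator v)                 ≡⟨ cong (sumF f +_) (sumF-scale (suc c) indicator) ⟩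
  sumF f + suc c * count small                              ≤⟨ +-monoˡ-≤ _ total ⟩
  c * n + suc c * count small                               ≡⟨ +-comm (c * n) _ ⟩
  suc c * count small + c * n                               ∎)
  where
  open ≤-Reasoning
  small : Fin n → Bool
  small v = f v ≤ᵇ c
  indicator : Fin n → ℕ
  indicator v = if small v then 1 else 0
  large-or-small : ∀ v → suc c ≤ f v + suc c * indicator v
  large-or-small v with small v in small-v
  ... | true  = ≤-trans (≤-reflexive (sym (*-identityʳ (suc c)))) (m≤n+m _ (f v))
  ... | false = ≤-trans (≰⇒> λ fv≤c → subst T small-v (≤⇒≤ᵇ fv≤c)) (m≤m+n (f v) _)

lookup-injective : {xs : List A} → Unique xs → ∀ i j → lookup xs i ≡ lookup xs j → i ≡ j
lookup-injective (_   AllPairs.∷ _) zero    zero    _  = refl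
lookup-injective (x∉ AllPairs.∷ _) zero    (suc j) eq = ⊥-elim (All.lookup x∉ (∈-lookup j) eq)
lookup-injective (x∉ AllPairs.∷ _) (suc i) zero    eq = ⊥-elim (All.lookup x∉ (∈-lookup i) (sym eq))
lookup-injective (_   AllPairs.∷ u) (suc i) (suc j) eq = cong suc (lookup-injective u i j eq)

unique-⊆⇒length-≤ : {xs ys : List A} → Unique xs → xs ⊆ ys → length xs ≤ length ys
unique-⊆⇒length-≤ u xs⊆ys = injective⇒≤ λ {i} {j} eq →
  lookup-injective u i j (index-injective (setoid _) (xs⊆ys (∈-lookup i)) (xs⊆ys (∈-lookup j)) eq)

map⁺-injectiveOn : {f : A → A} (P : A → Set) → (∀ {x y} → P x → P y → f x ≡ f y → x ≡ y) →
                   {xs : List A} → All P xs → Unique xs → Unique (map f xs)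
map⁺-injectiveOn P inj All.[]           AllPairs.[]         = AllPairs.[]
map⁺-injectiveOn P inj (px All.∷ pxs) (x∉ AllPairs.∷ u) =
  All.map⁺ (All.zipWith (λ (x≢y , py) fx≡fy → x≢y (inj px py fx≡fy)) (x∉ , pxs))
    AllPairs.∷ map⁺-injectiveOn P inj pxs u

holds? : (p : A → Bool) → Decidable (λ x → p x ≡ true)
holds? p x = p x ≟ᵇ true

select : (A → Bool) → List A → List A
select p = filter (holds? p)

length-select-split : (p q : A → Bool) (xs : List A) →
  length (select p xs) ≡ length (select (λ x → p x ∧ q x) xs) + length (select (λ x → p x ∧ not (q x)) xs)
length-select-split p q []       = refl
length-select-split p q (x ∷ xs) with p x | q x
... | true  | true  = cong suc (length-select-split p q xs)
... | true  | false = trans (cong suc (length-select-split p q xs)) (sym (+-suc _ _))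
... | false | _     = length-select-split p q xs

length-select-tabulate : (p : A → Bool) (f : Fin n → A) →
                         length (select p (tabulate f)) ≡ count (λ i → p (f i))
length-select-tabulate {n = zero}  p f = refl
length-select-tabulate {n = suc n} p f with p (f zero)
... | true  = cong suc (length-select-tabulate p (λ i → f (suc i)))
... | false = length-select-tabulate p (λ i → f (suc i))

length-select-cartesianProduct :
  ∀ {B : Set} (p : A × B → Bool) (f : Fin n → A) (g : Fin k → B) →
  length (select p (cartesianProduct (tabulate f) (tabulate g))) ≡ sumF (λ i → count (λ j → p (f i , g j)))
length-select-cartesianProduct {n = zero}  p f g = refl
length-select-cartesianProduct {n = suc n} {B = B} p f g = begin
  length (select p (row ++ rows))                 ≡⟨ cong length (filter-++ _ row rows) ⟩
  length (select p row ++ select p rows)          ≡⟨ length-++ (select p row) ⟩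
  length (select p row) + length (select p rows)
    ≡⟨ cong₂ _+_ (trans (cong (λ xs → length (select p xs)) (map-tabulate g (f zero ,_)))
                        (length-select-tabulate p (λ j → f zero , g j)))
                 (length-select-cartesianProduct p (λ i → f (suc i)) g) ⟩
  sumF (λ i → count (λ j → p (f i , g j)))        ∎
  where
  open ≡-Reasoning
  row rows : List (_ × B)
  row  = map (f zero ,_) (tabulate g)
  rows = cartesianProduct (tabulate (λ i → f (suc i))) (tabulate g)

-- Orbits of a partial injection on a finite set

module PartialInjection
  (f : A → A) (S : A → Bool)
  (N : ℕ) (code : A → ℕ) (code-injective : ∀ {x y} → code x ≡ code y → x ≡ y) (code-< : ∀ x → code x < N)
  (f-closed : ∀ {x} → S x ≡ true → S (f x) ≡ true)
  (f-injective : ∀ {x y} → S x ≡ true → S y ≡ true → f x ≡ f y → x ≡ y)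
  where

  iter-closed : ∀ k {x} → S x ≡ true → S (iter k f x) ≡ true
  iter-closed zero    sx = sx
  iter-closed (suc k) sx = f-closed (iter-closed k sx)

  iter-injective : ∀ k {x y} → S x ≡ true → S y ≡ true → iter k f x ≡ iter k f y → x ≡ y
  iter-injective zero    sx sy eq = eq
  iter-injective (suc k) sx sy eq = iter-injective k sx sy (f-injective (iter-closed k sx) (iter-closed k sy) eq)

  period : ∀ {x} → S x ≡ true → ∃[ p ] (p < N × iter (suc p) f x ≡ x)
  period {x} sx
    with i , j , i<j , same ← pigeonhole (n<1+n N) (λ i → fromℕ< (code-< (iter (toℕ i) f x)))
    with p , i+1+p≡j ← m≤n⇒∃[o]m+o≡n i<j
    = p , p<N , sym (iter-injective (toℕ i) sx (iter-closed (suc p) sx) same-iterate)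
    where
    open ≡-Reasoning
    same-iterate : iter (toℕ i) f x ≡ iter (toℕ i) f (iter (suc p) f x)
    same-iterate = begin
      iter (toℕ i) f x                  ≡⟨ code-injective (trans (sym (toℕ-fromℕ< _))
                                                                  (trans (cong toℕ same) (toℕ-fromℕ< _))) ⟩
      iter (toℕ j) f x                  ≡⟨ cong (λ m → iter m f x) (trans (sym i+1+p≡j) (sym (+-suc (toℕ i) p))) ⟩
      iter (toℕ i + suc p) f x          ≡⟨ iter-+ (toℕ i) (suc p) f x ⟩
      iter (toℕ i) f (iter (suc p) f x) ∎
    p<N : p < N
    p<N = ≤-trans (s≤s (m≤n+m p (toℕ i))) (subst (_≤ N) (sym i+1+p≡j) (s≤s⁻¹ (toℕ<n j)))

  orbit-returns : ∀ {x} → S x ≡ true → ∀ m → ∃[ m′ ] iter m′ f (iter m f x) ≡ x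
  orbit-returns {x} sx m with p , _ , periodic ← period sx = m * p , (begin
    iter (m * p) f (iter m f x)  ≡⟨ iter-+ (m * p) m f x ⟨
    iter (m * p + m) f x         ≡⟨ cong (λ k → iter k f x) (trans (+-comm (m * p) m) (sym (*-suc m p))) ⟩
    iter (m * suc p) f x         ≡⟨ iter-periodic (suc p) f periodic m ⟩
    x                            ∎)
    where open ≡-Reasoning

  -- For f = faceStep ρ, S = isDart, code = dartCode and N = n * n this is literally the predicate
  -- counted by faceCount: every orbit has at most N elements and is counted at its code-least one.
  orbitLeader : A → Bool
  orbitLeader x = S x ∧ allBelow N (λ k → code x ≤ᵇ code (iter k f x))

  orbitLeader-minimal : ∀ {x} → orbitLeader x ≡ true → ∀ m → code x ≤ code (iter m f x)
  orbitLeader-minimal {x} lead m with p , p<N , periodic ← period (∧-conicalˡ _ _ lead) =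
    ≤-trans (≤ᵇ⇒≤ _ _ (Equivalence.from T-≡ below-N)) (≤-reflexive (cong code (sym m-reduces)))
    where
    open ≡-Reasoning
    below-N : (code x ≤ᵇ code (iter (m % suc p) f x)) ≡ true
    below-N = allBelow-elim N _ (∧-conicalʳ _ _ lead) (<-≤-trans (m%n<n m (suc p)) p<N)
    m-reduces : iter m f x ≡ iter (m % suc p) f x
    m-reduces = begin
      iter m f x                                         ≡⟨ cong (λ k → iter k f x) (m≡m%n+[m/n]*n m (suc p)) ⟩
      iter (m % suc p + m / suc p * suc p) f x           ≡⟨ iter-+ (m % suc p) _ f x ⟩
      iter (m % suc p) f (iter (m / suc p * suc p) f x)
        ≡⟨ cong (iter (m % suc p) f) (iter-periodic (suc p) f periodic (m / suc p)) ⟩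
      iter (m % suc p) f x                               ∎

  orbitLeaders-equal : ∀ {x y} → orbitLeader x ≡ true → orbitLeader y ≡ true → ∀ m → iter m f x ≡ y → x ≡ y
  orbitLeaders-equal {x} lead-x lead-y m refl with m′ , returns ← orbit-returns (∧-conicalˡ _ _ lead-x) m =
    code-injective (≤-antisym (orbitLeader-minimal lead-x m)
                              (subst (λ z → code (iter m f x) ≤ code z) returns (orbitLeader-minimal lead-y m′)))

  _≟ᴬ_ : DecidableEquality A
  x ≟ᴬ y = map′ code-injective (cong code) (code x ≟ℕ code y)

  twoOrbitLeader longOrbitLeader : A → Bool
  twoOrbitLeader  x = orbitLeader x ∧ ⌊ f (f x) ≟ᴬ x ⌋
  longOrbitLeader x = orbitLeader x ∧ not ⌊ f (f x) ≟ᴬ x ⌋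

  module _ (fixpoint-free : ∀ {x} → S x ≡ true → f x ≢ x)
           {as : List A} (as-unique : Unique as) (as-complete : ∀ x → x ∈ as) where

    leader≢successor : ∀ {x y} → orbitLeader x ≡ true → orbitLeader y ≡ true → y ≢ f x
    leader≢successor {x} lead-x lead-y refl =
      fixpoint-free (∧-conicalˡ _ _ lead-x) (sym (orbitLeaders-equal lead-x lead-y 1 refl))

    private
      L L₃ : List A
      L  = select orbitLeader as
      L₃ = select longOrbitLeader as

      leader∈L : ∀ {x} → x ∈ L → orbitLeader x ≡ true
      leader∈L x∈L = proj₂ (∈-filter⁻ (holds? orbitLeader) {xs = as} x∈L)

      long∈L₃ : ∀ {x} → x ∈ L₃ → longOrbitLeader x ≡ true
      long∈L₃ x∈L₃ = proj₂ (∈-filter⁻ (holds? longOrbitLeader) {xs = as} x∈L₃)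

      leader∈L₃ : ∀ {x} → x ∈ L₃ → orbitLeader x ≡ true
      leader∈L₃ x∈L₃ = ∧-conicalˡ _ _ (long∈L₃ x∈L₃)

      f²≢id∈L₃ : ∀ {x} → x ∈ L₃ → f (f x) ≢ x
      f²≢id∈L₃ {x} x∈L₃ =
        toWitnessFalse {a? = f (f x) ≟ᴬ x} (Equivalence.from T-≡ (∧-conicalʳ (orbitLeader x) _ (long∈L₃ x∈L₃)))

      S∈L : ∀ {x} → x ∈ L → S x ≡ true
      S∈L x∈L = ∧-conicalˡ _ _ (leader∈L x∈L)

      S∈L₃ : ∀ {x} → x ∈ L₃ → S x ≡ true
      S∈L₃ x∈L₃ = ∧-conicalˡ _ _ (leader∈L₃ x∈L₃)

    -- The first two elements of every orbit and the third one of every orbit longer than two: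
    -- pairwise distinct elements of S, three per orbit except for orbits of length two.
    orbitPrefixes : List A
    orbitPrefixes = L ++ map f L ++ map (f ∘ f) L₃

    orbitPrefixes-unique : Unique orbitPrefixes
    orbitPrefixes-unique = Unique.++⁺ L-unique
      (Unique.++⁺ (map⁺-injectiveOn (λ x → S x ≡ true) f-injective (All.tabulate S∈L) L-unique)
                  (map⁺-injectiveOn (λ x → S x ≡ true) (iter-injective 2) (All.tabulate S∈L₃) L₃-unique)
                  successors-disjoint)
      leaders-disjoint
      where
      L-unique : Unique L
      L-unique  = Unique.filter⁺ (holds? orbitLeader) as-unique
      L₃-unique : Unique L₃
      L₃-unique = Unique.filter⁺ (holds? longOrbitLeader) as-unique

      successors-disjoint : Disjoint (map f L) (map (f ∘ f) L₃)
      successors-disjoint (v∈fL , v∈ffL₃)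
        with x , x∈L , refl ← ∈-map⁻ f v∈fL
        with y , y∈L₃ , fx≡ffy ← ∈-map⁻ (f ∘ f) v∈ffL₃ =
        leader≢successor (leader∈L₃ y∈L₃) (leader∈L x∈L) (f-injective (S∈L x∈L) (f-closed (S∈L₃ y∈L₃)) fx≡ffy)

      leaders-disjoint : Disjoint L (map f L ++ map (f ∘ f) L₃)
      leaders-disjoint (v∈L , v∈rest) with ∈-++⁻ (map f L) v∈rest
      ... | inj₁ v∈fL with x , x∈L , refl ← ∈-map⁻ f v∈fL =
        leader≢successor (leader∈L x∈L) (leader∈L v∈L) refl
      ... | inj₂ v∈ffL₃ with x , x∈L₃ , refl ← ∈-map⁻ (f ∘ f) v∈ffL₃ =
        f²≢id∈L₃ x∈L₃ (sym (orbitLeaders-equal (leader∈L₃ x∈L₃) (leader∈L v∈L) 2 refl))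

    orbitPrefixes-⊆ : orbitPrefixes ⊆ select S as
    orbitPrefixes-⊆ {x} x∈prefixes = ∈-filter⁺ (holds? S) (as-complete x) (S-member x∈prefixes)
      where
      S-member : ∀ {x} → x ∈ orbitPrefixes → S x ≡ true
      S-member x∈prefixes with ∈-++⁻ L x∈prefixes
      ... | inj₁ x∈L = S∈L x∈L
      ... | inj₂ x∈rest with ∈-++⁻ (map f L) x∈rest
      ...   | inj₁ x∈fL   with y , y∈L , refl ← ∈-map⁻ f x∈fL = f-closed (S∈L y∈L)
      ...   | inj₂ x∈ffL₃ with y , y∈L₃ , refl ← ∈-map⁻ (f ∘ f) x∈ffL₃ = iter-closed 2 (S∈L₃ y∈L₃)

    orbitLeader-count :
      3 * length (select orbitLeader as) ≤ length (select S as) + length (select twoOrbitLeader as)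
    orbitLeader-count = begin
      3 * ∣L∣                                     ≡⟨ cong (3 *_) split ⟩
      3 * (∣K∣ + ∣L₃∣)                            ≡⟨ rearrange ∣K∣ ∣L₃∣ ⟩
      (∣K∣ + ∣L₃∣) + ((∣K∣ + ∣L₃∣) + ∣L₃∣) + ∣K∣  ≡⟨ cong (λ l → l + (l + ∣L₃∣) + ∣K∣) split ⟨
      ∣L∣ + (∣L∣ + ∣L₃∣) + ∣K∣                    ≡⟨ cong (_+ ∣K∣) length-orbitPrefixes ⟨
      length orbitPrefixes + ∣K∣
        ≤⟨ +-monoˡ-≤ ∣K∣ (unique-⊆⇒length-≤ orbitPrefixes-unique orbitPrefixes-⊆) ⟩
      length (select S as) + ∣K∣                  ∎
      where
      open ≤-Reasoning
      ∣L∣ ∣L₃∣ ∣K∣ : ℕ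
      ∣L∣  = length L
      ∣L₃∣ = length L₃
      ∣K∣  = length (select twoOrbitLeader as)

      split : ∣L∣ ≡ ∣K∣ + ∣L₃∣
      split = length-select-split orbitLeader (λ x → ⌊ f (f x) ≟ᴬ x ⌋) as

      rearrange : ∀ k l → 3 * (k + l) ≡ (k + l) + ((k + l) + l) + k
      rearrange = solve-∀

      length-orbitPrefixes : length orbitPrefixes ≡ ∣L∣ + (∣L∣ + ∣L₃∣)
      length-orbitPrefixes = trans (length-++ L) (cong (∣L∣ +_) (trans (length-++ (map f L))
                               (cong₂ _+_ (length-map f L) (length-map (f ∘ f) L₃))))

-- Faces and components of a plane embedding

-- Three times the Euler relation, with the face bound doubled and the component bound
-- multiplied by six, leaves D + 6C ≤ 6n.
euler-bound : ∀ n F I D C K → 2 * n + 2 * F + 2 * I ≡ D + 4 * C → 3 * F ≤ D + K → K + I ≤ C → D ≤ 6 * n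
euler-bound n F I D C K euler faces components =
  ≤-trans (m≤m+n D (6 * C)) (+-cancelʳ-≤ (2 * D + 6 * C) (D + 6 * C) (6 * n) (begin
    D + 6 * C + (2 * D + 6 * C)      ≡⟨ solve (D ∷ C ∷ []) ⟩
    3 * (D + 4 * C)                  ≡⟨ cong (3 *_) euler ⟨
    3 * (2 * n + 2 * F + 2 * I)      ≡⟨ solve (n ∷ F ∷ I ∷ []) ⟩
    6 * n + 2 * (3 * F) + 6 * I      ≤⟨ +-monoˡ-≤ (6 * I) (+-monoʳ-≤ (6 * n) (*-monoʳ-≤ 2 faces)) ⟩
    6 * n + 2 * (D + K) + 6 * I      ≡⟨ solve (n ∷ D ∷ K ∷ I ∷ []) ⟩
    6 * n + 2 * D + (2 * K + 6 * I)  ≤⟨ +-monoʳ-≤ (6 * n + 2 * D)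
                                            (+-monoˡ-≤ (6 * I) (*-monoˡ-≤ K {2} {6} (s≤s (s≤s z≤n)))) ⟩
    6 * n + 2 * D + (6 * K + 6 * I)  ≡⟨ cong (6 * n + 2 * D +_) (*-distribˡ-+ 6 K I) ⟨
    6 * n + 2 * D + 6 * (K + I)      ≤⟨ +-monoʳ-≤ (6 * n + 2 * D) (*-monoʳ-≤ 6 components) ⟩
    6 * n + 2 * D + 6 * C            ≡⟨ +-assoc (6 * n) (2 * D) (6 * C) ⟩
    6 * n + (2 * D + 6 * C)          ∎))
  where open ≤-Reasoning

darts : (n : ℕ) → List (Fin n × Fin n)
darts n = cartesianProduct (allFin n) (allFin n)

darts-unique : Unique (darts n)
darts-unique {n} = Unique.cartesianProduct⁺ (Unique.allFin⁺ n) (Unique.allFin⁺ n)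

darts-complete : (d : Fin n × Fin n) → d ∈ darts n
darts-complete (v , u) = ∈-cartesianProduct⁺ (∈-allFin v) (∈-allFin u)

length-select-darts : (p : Fin n × Fin n → Bool) →
                      length (select p (darts n)) ≡ sumF (λ v → count (λ u → p (v , u)))
length-select-darts p = length-select-cartesianProduct p (λ v → v) (λ u → u)

module _ {n : ℕ} (G : Graph n) where

  adj-flip : ∀ {u v} → adj G u v ≡ true → adj G v u ≡ true
  adj-flip {u} {v} uv = trans (adj-sym G v u) uv

  isDart : Fin n × Fin n → Bool
  isDart (v , u) = adj G v u

  dartCode≡combine : ∀ v u → dartCode G (v , u) ≡ toℕ (combine v u)
  dartCode≡combine v u = trans (cong (_+ toℕ u) (*-comm (toℕ v) n)) (sym (toℕ-combine v u))

  dartCode-injective : ∀ {d d′} → dartCode G d ≡ dartCode G d′ → d ≡ d′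
  dartCode-injective {v , u} {v′ , u′} eq
    with refl , refl ← combine-injective v u v′ u′
           (toℕ-injective (trans (sym (dartCode≡combine v u)) (trans eq (dartCode≡combine v′ u′)))) = refl

  dartCode-< : ∀ d → dartCode G d < n * n
  dartCode-< (v , u) = subst (_< n * n) (sym (dartCode≡combine v u)) (toℕ<n (combine v u))

  dartCode-monoˡ-< : ∀ {v v′} u u′ → toℕ v < toℕ v′ → dartCode G (v , u) < dartCode G (v′ , u′)
  dartCode-monoˡ-< {v} {v′} u u′ v<v′ = subst₂ _<_ (sym (dartCode≡combine v u)) (sym (dartCode≡combine v′ u′))
                                                   (combine-monoˡ-< u u′ v<v′)

  componentLeader : Fin n → Bool
  componentLeader v = allF (λ w → not (reach G n v w) ∨ (toℕ v ≤ᵇ toℕ w))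

  module _ (P : Fin n → Set) (closed : ∀ {x w} → P x → adj G x w ≡ true → P w) where

    reach-closed : ∀ {v} → P v → ∀ k w → reach G k v w ≡ true → P w
    reach-closed pv zero    w v≡w = subst P (toWitness (Equivalence.from T-≡ v≡w)) pv
    reach-closed {v} pv (suc k) w r with reach G k v w in r-k
    ... | true  = reach-closed pv k w r-k
    ... | false with x , step ← anyF-witness _ r =
      closed (reach-closed pv k x (∧-conicalˡ _ _ step)) (∧-conicalʳ _ _ step)

    least-of-closed⇒componentLeader : ∀ {v} → P v → (∀ {w} → P w → toℕ v ≤ toℕ w) → componentLeader v ≡ true
    least-of-closed⇒componentLeader {v} pv least = allF-intro _ bounded
      where
      bounded : ∀ w → (not (reach G n v w) ∨ (toℕ v ≤ᵇ toℕ w)) ≡ true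
      bounded w with reach G n v w in r
      ... | false = refl
      ... | true  = Equivalence.to T-≡ (≤⇒≤ᵇ (least (reach-closed pv n w r)))

  isolated⇒componentLeader : ∀ {v} → anyF (adj G v) ≡ false → componentLeader v ≡ true
  isolated⇒componentLeader {v} isolated = least-of-closed⇒componentLeader (_≡ v) closed refl λ { refl → ≤-refl }
    where
    closed : ∀ {x w} → x ≡ v → adj G x w ≡ true → w ≡ v
    closed refl vw with () ← trans (sym (anyF-intro (adj G v) _ vw)) isolated

  module _ {ρ : Fin n → Fin n → Fin n} (rotation : IsRotation G ρ) where

    rotation-injective : ∀ v {u w} → adj G v u ≡ true → adj G v w ≡ true → ρ v u ≡ ρ v w → u ≡ w
    rotation-injective v = single-orbit⇒injectiveOn (ρ v) (λ u → adj G v u ≡ true)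
                              (proj₁ rotation v _) (proj₂ rotation v _ _)

    rotation-fixed⇒sole-neighbour : ∀ {u v w} → adj G u v ≡ true → ρ u v ≡ v → adj G u w ≡ true → w ≡ v
    rotation-fixed⇒sole-neighbour {u} {v} {w} uv fixed uw with k , v↦w ← proj₂ rotation u v w uv uw =
      trans (sym v↦w) (iter-fixed k (ρ u) fixed)

    faceStep-closed : ∀ {d} → isDart d ≡ true → isDart (faceStep G ρ d) ≡ true
    faceStep-closed {v , u} vu = proj₁ rotation u v (adj-flip vu)

    faceStep-injective : ∀ {d d′} → isDart d ≡ true → isDart d′ ≡ true →
                         faceStep G ρ d ≡ faceStep G ρ d′ → d ≡ d′
    faceStep-injective {v , u} {v′ , u′} vu v′u′ eq with refl ← cong proj₁ eq =
      cong (_, u) (rotation-injective u (adj-flip vu) (adj-flip v′u′) (cong proj₂ eq))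

    faceStep-fixpoint-free : ∀ {d} → isDart d ≡ true → faceStep G ρ d ≢ d
    faceStep-fixpoint-free {v , u} vu eq with refl ← cong proj₁ eq with () ← trans (sym vu) (irref G v)

    open PartialInjection (faceStep G ρ) isDart (n * n) (dartCode G) dartCode-injective dartCode-<
                          faceStep-closed faceStep-injective

    twoFaceCount : ℕ
    twoFaceCount = sumF (λ v → count (λ u → twoOrbitLeader (v , u)))

    faceCount-bound : 3 * faceCount G ρ ≤ dartCount G + twoFaceCount
    faceCount-bound = begin
      3 * faceCount G ρ                             ≡⟨ cong (3 *_) (length-select-darts orbitLeader) ⟨
      3 * length (select orbitLeader (darts n))
        ≤⟨ orbitLeader-count faceStep-fixpoint-free darts-unique darts-complete ⟩
      length (select isDart (darts n)) + length (select twoOrbitLeader (darts n))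
        ≡⟨ cong₂ _+_ (length-select-darts isDart) (length-select-darts twoOrbitLeader) ⟩
      dartCount G + twoFaceCount                    ∎
      where open ≤-Reasoning

    module _ {v u : Fin n} (two : twoOrbitLeader (v , u) ≡ true) where

      private
        leader : orbitLeader (v , u) ≡ true
        leader = ∧-conicalˡ _ _ two

        returns : faceStep G ρ (faceStep G ρ (v , u)) ≡ (v , u)
        returns = toWitness (Equivalence.from T-≡ (∧-conicalʳ (orbitLeader (v , u)) _ two))

        ρuv≡v : ρ u v ≡ v
        ρuv≡v = cong proj₁ returns

        ρvu≡u : ρ v u ≡ u
        ρvu≡u = subst (λ z → ρ z u ≡ u) ρuv≡v (cong proj₂ returns)

      twoFace-adj : adj G v u ≡ true
      twoFace-adj = ∧-conicalˡ _ _ leader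

      twoFace-sole-neighbours : (∀ {w} → adj G v w ≡ true → w ≡ u) × (∀ {w} → adj G u w ≡ true → w ≡ v)
      twoFace-sole-neighbours = rotation-fixed⇒sole-neighbour twoFace-adj ρvu≡u
                              , rotation-fixed⇒sole-neighbour (adj-flip twoFace-adj) ρuv≡v

      twoFace-ordered : toℕ v ≤ toℕ u
      twoFace-ordered = ≮⇒≥ λ u<v → <⇒≱ (dartCode-monoˡ-< (ρ u v) u u<v) (orbitLeader-minimal leader 1)

    twoFace⇒componentLeader : ∀ {v u} → twoOrbitLeader (v , u) ≡ true → componentLeader v ≡ true
    twoFace⇒componentLeader {v} {u} two =
      least-of-closed⇒componentLeader (λ w → w ≡ v ⊎ w ≡ u) closed (inj₁ refl) least
      where
      closed : ∀ {x w} → x ≡ v ⊎ x ≡ u → adj G x w ≡ true → w ≡ v ⊎ w ≡ u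
      closed (inj₁ refl) xw = inj₂ (proj₁ (twoFace-sole-neighbours two) xw)
      closed (inj₂ refl) xw = inj₁ (proj₂ (twoFace-sole-neighbours two) xw)
      least : ∀ {w} → w ≡ v ⊎ w ≡ u → toℕ v ≤ toℕ w
      least (inj₁ refl) = ≤-refl
      least (inj₂ refl) = twoFace-ordered two

    -- A component is charged only at its least vertex, and only if it is an isolated vertex
    -- or an isolated edge.
    componentLeader-charge : ∀ v → count (λ u → twoOrbitLeader (v , u)) + (if not (anyF (adj G v)) then 1 else 0)
                                   ≤ (if componentLeader v then 1 else 0)
    componentLeader-charge v with anyF (adj G v) in has-neighbour | componentLeader v in leads
    ... | false | true  = ≤-reflexive (cong (_+ 1) (count-≡0 (λ u → twoOrbitLeader (v , u)) λ u two →
                            case trans (sym (anyF-intro (adj G v) u (twoFace-adj two))) has-neighbour of λ ()))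
    ... | false | false = case trans (sym (isolated⇒componentLeader has-neighbour)) leads of λ ()
    ... | true  | true  = ≤-trans (≤-reflexive (+-identityʳ _)) (count-≤1 (λ u → twoOrbitLeader (v , u))
                            λ u u′ two two′ → proj₁ (twoFace-sole-neighbours two′) (twoFace-adj two))
    ... | true  | false = ≤-reflexive (trans (+-identityʳ _) (count-≡0 (λ u → twoOrbitLeader (v , u)) λ u two →
                            case trans (sym (twoFace⇒componentLeader two)) leads of λ ()))

    componentCount-bound : twoFaceCount + isolatedCount G ≤ componentCount G
    componentCount-bound = ≤-trans (≤-reflexive (sym (sumF-+ (λ v → count (λ u → twoOrbitLeader (v , u))) _)))
                                   (sumF-mono componentLeader-charge)

  planar⇒dartCount≤6n : Planar G → dartCount G ≤ 6 * n
  planar⇒dartCount≤6n (ρ , rotation , euler) =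
    euler-bound n (faceCount G ρ) (isolatedCount G) (dartCount G) (componentCount G) (twoFaceCount rotation)
                euler (faceCount-bound rotation) (componentCount-bound rotation)

-- Colour classes

monochromatic⇒independent : ∀ {n k} (G : Graph n) {c : Fin n → Fin k} → ProperColoring G k c →
                            ∀ {I a} → (∀ v → I v ≡ true → c v ≡ a) → Independent G I
monochromatic⇒independent G proper mono u v Iu Iv with adj G u v in uv
... | false = refl
... | true  = ⊥-elim (proper u v uv (trans (mono u Iu) (sym (mono v Iv))))

module _ {n : ℕ} (G : Graph n) (α : Fin n → Fin 5) (β : Fin n → Fin 4) where

  lowDegree : Fin n → Bool
  lowDegree v = degree G v ≤ᵇ 6

  colourClass : Fin 5 → Fin 4 → Fin n → Bool
  colourClass a b v = (lowDegree v ∧ ⌊ α v ≟ a ⌋) ∧ ⌊ β v ≟ b ⌋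

  colourClass-sound : ∀ {a b v} → colourClass a b v ≡ true → degree G v ≤ 6 × α v ≡ a × β v ≡ b
  colourClass-sound {a} {b} {v} member =
      ≤ᵇ⇒≤ _ _ (Equivalence.from T-≡ (∧-conicalˡ _ _ low∧αv≡a))
    , toWitness (Equivalence.from T-≡ (∧-conicalʳ (lowDegree v) _ low∧αv≡a))
    , toWitness (Equivalence.from T-≡ (∧-conicalʳ (lowDegree v ∧ ⌊ α v ≟ a ⌋) _ member))
    where
    low∧αv≡a : (lowDegree v ∧ ⌊ α v ≟ a ⌋) ≡ true
    low∧αv≡a = ∧-conicalˡ _ _ member

  large-colourClass : dartCount G ≤ 6 * n → ∃[ a ] ∃[ b ] n ≤ 140 * count (colourClass a b)
  large-colourClass few-darts = a , b , (begin
      n                                                  ≤⟨ many-small-terms (degree G) 6 few-darts ⟩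
      7 * count lowDegree                                ≤⟨ *-monoʳ-≤ 7 many-a ⟩
      7 * (5 * count (λ v → lowDegree v ∧ ⌊ α v ≟ a ⌋))  ≤⟨ *-monoʳ-≤ 7 (*-monoʳ-≤ 5 many-b) ⟩
      7 * (5 * (4 * count (colourClass a b)))            ≡⟨ *-assoc 7 5 (4 * count (colourClass a b)) ⟨
      35 * (4 * count (colourClass a b))                 ≡⟨ *-assoc 35 4 (count (colourClass a b)) ⟨
      140 * count (colourClass a b)                      ∎)
    where
    open ≤-Reasoning
    a : Fin 5
    a = proj₁ (count-pigeonhole lowDegree α)
    many-a : count lowDegree ≤ 5 * count (λ v → lowDegree v ∧ ⌊ α v ≟ a ⌋)
    many-a = proj₂ (count-pigeonhole lowDegree α)
    b : Fin 4
    b = proj₁ (count-pigeonhole (λ v → lowDegree v ∧ ⌊ α v ≟ a ⌋) β)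
    many-b : count (λ v → lowDegree v ∧ ⌊ α v ≟ a ⌋) ≤ 4 * count (colourClass a b)
    many-b = proj₂ (count-pigeonhole (λ v → lowDegree v ∧ ⌊ α v ≟ a ⌋) β)

lemma3p2 : (n : ℕ) (G : Graph n) → Planar G →
    (α : Fin n → Fin 5) → ProperColoring G 5 α →
    (β : Fin n → Fin 4) → ProperColoring G 4 β →
    ∃[ I ] (Independent G I
      × (∀ v → I v ≡ true → degree G v ≤ 6)
      × (∃[ a ] ∃[ b ] (∀ v → I v ≡ true → (α v ≡ a) × (β v ≡ b)))
      × n ≤ 140 * count I)
lemma3p2 n G planar α α-proper β _ =
  let a , b , large = large-colourClass G α β (planar⇒dartCount≤6n G planar) in
    colourClass G α β a b
  , monochromatic⇒independent G α-proper (λ v → proj₁ ∘ proj₂ ∘ colourClass-sound G α β)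
  , (λ v → proj₁ ∘ colourClass-sound G α β)
  , (a , b , λ v → proj₂ ∘ colourClass-sound G α β)
  , large
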